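{- Let $n\geq 1$ and $0\leq k\leq n-1$ be integers. There is a bijection between the set $A_k$ of Catalan paths $P$ of order $n$ with $\mathrm{valley}(P)=k$ and the set $B_k$ of Catalan paths $P$ of order $n$ with $\mathrm{enor}(P)=k$.
   Context: A Catalan path of order $n$ is a word $P=p_1p_2\cdots p_{2n}$ in the letters $\mathbf{N}=(0,1)$ and $\mathbf{E}=(1,0)$ with exactly $n$ of each letter such that every prefix contains at least as many $\mathbf{N}$'s as $\mathbf{E}$'s. $\mathrm{valley}(P)$ is the number of indices $i$ with $p_i=\mathbf{E}$ and $p_{i+1}=\mathbf{N}$. $\mathrm{enor}(P)$ is the number of indices $i\in\{1,\dots,n\}$ with $p_{2i}=\mathbf{N}$. -}

module Defs where

open import Data.Nat using (ℕ; zero; suc; _+_; _*_; _≡ᵇ_)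
open import Data.Bool using (Bool; true; false; _∧_; T)
open import Data.List using (List; []; _∷_; length)
open import Data.Product using (Σ; proj₁)
open import Relation.Binary.PropositionalEquality using (_≡_)

data Step : Set where
  N E : Step

-- Running check of the prefix condition: the argument h is the current
-- (#N - #E) of the prefix read so far; an E at height 0 would violate it.
balanced : ℕ → List Step → Bool
balanced zero    []      = true
balanced (suc h) []      = false
balanced h       (N ∷ w) = balanced (suc h) w
balanced zero    (E ∷ w) = false
balanced (suc h) (E ∷ w) = balanced h w

-- A word is a Catalan path of order n: length 2n, n letters of each kind
-- (implied by balance + length), and every prefix has at least as many N's as E's.
isCatalan : ℕ → List Step → Bool
isCatalan n w = (length w ≡ᵇ 2 * n) ∧ balanced zero w

CatalanPath : ℕ → Set
CatalanPath n = Σ (List Step) (λ w → T (isCatalan n w))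

valley : List Step → ℕ
valley (E ∷ N ∷ w) = suc (valley (N ∷ w))
valley (_ ∷ w)     = valley w
valley []          = 0

-- enor(P): number of i ≥ 1 with p_{2i} = N (N's at even positions, 1-indexed).
enor : List Step → ℕ
enor (_ ∷ N ∷ w) = suc (enor w)
enor (_ ∷ E ∷ w) = enor w
enor (_ ∷ [])    = 0
enor []          = 0

A : ℕ → ℕ → Set
A n k = Σ (CatalanPath n) (λ P → valley (proj₁ P) ≡ k)

B : ℕ → ℕ → Set
B n k = Σ (CatalanPath n) (λ P → enor (proj₁ P) ≡ k)

-- Via the first-return decomposition P = N P₁ E P₂, Catalan paths of order n are binary
-- trees with n nodes.  On a tree node l r, valley counts valleys l + [r ≠ leaf] + valleys r,
-- while enor counts the N's of r at even positions plus those of l at odd positions (l is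
-- shifted by one letter).  The size-preserving bijection φ (node l r) = node (ψ r) (φ l),
-- ψ (node l r) = node (φ l) (ψ r) trades the first statistic for the second, since by a
-- simultaneous induction the even-position count of φ t is valleys t and the odd-position
-- count of ψ t is [t ≠ leaf] + valleys t.
module Submission where

open import Defs
open import Data.Nat using (ℕ; zero; suc; _+_; _*_; _≤_; _<_)
open import Data.Nat.Properties using (+-assoc; +-comm; *-cancelˡ-≡; ≡-irrelevant; ≡ᵇ⇒≡; ≡⇒≡ᵇ)
open import Data.Nat.Tactic.RingSolver using (solve-∀)
open import Data.Bool using (true; T)
open import Data.Bool.Properties using (T-irrelevant; T-∧)
open import Data.List using (List; []; _∷_; _++_; length)
open import Data.List.Properties using (++-assoc; ++-identityʳ; length-++; ∷-injectiveʳ)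
open import Data.Vec using (Vec; []; _∷_)
open import Data.Product using (Σ; _,_; proj₁; proj₂; _×_)
open import Data.Product.Function.Dependent.Propositional using (Σ-↔)
open import Function.Bundles using (_⤖_; _↔_; mk↔ₛ′; Equivalence)
open import Function.Properties.Inverse using (↔-sym; ↔-trans; ↔⇒⤖)
open import Function.Related.Propositional using (K-reflexive)
open import Relation.Binary.PropositionalEquality
open ≡-Reasoning

data Tree : Set where
  leaf : Tree
  node : Tree → Tree → Tree

enc : Tree → List Step
enc leaf       = []
enc (node l r) = N ∷ (enc l ++ E ∷ enc r)

size : Tree → ℕ
size leaf       = 0
size (node l r) = suc (size l + size r)

enc-node-++ : ∀ l r x → enc (node l r) ++ x ≡ N ∷ (enc l ++ E ∷ (enc r ++ x))
enc-node-++ l r x = cong (N ∷_) (++-assoc (enc l) (E ∷ enc r) x)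

length-enc : ∀ t → length (enc t) ≡ 2 * size t
length-enc leaf       = refl
length-enc (node l r) = begin
  suc (length (enc l ++ E ∷ enc r))           ≡⟨ cong suc (length-++ (enc l)) ⟩
  suc (length (enc l) + suc (length (enc r))) ≡⟨ cong₂ (λ a b → suc (a + suc b)) (length-enc l) (length-enc r) ⟩
  suc (2 * size l + suc (2 * size r))         ≡⟨ arith (size l) (size r) ⟩
  2 * size (node l r)                         ∎
  where
  arith : ∀ a b → suc (2 * a + suc (2 * b)) ≡ 2 * suc (a + b)
  arith = solve-∀

enc-++-E-injective : ∀ t u {x y} → enc t ++ E ∷ x ≡ enc u ++ E ∷ y → t ≡ u × x ≡ y
enc-++-E-injective leaf       leaf         eq = refl , ∷-injectiveʳ eq
enc-++-E-injective (node l r) (node l′ r′) {x} {y} eq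
  with enc-++-E-injective l l′ (∷-injectiveʳ (begin
         N ∷ (enc l ++ E ∷ (enc r ++ E ∷ x))    ≡⟨ enc-node-++ l r (E ∷ x) ⟨
         enc (node l r) ++ E ∷ x                ≡⟨ eq ⟩
         enc (node l′ r′) ++ E ∷ y              ≡⟨ enc-node-++ l′ r′ (E ∷ y) ⟩
         N ∷ (enc l′ ++ E ∷ (enc r′ ++ E ∷ y))  ∎))
... | refl , eqʳ with enc-++-E-injective r r′ eqʳ
...   | refl , x≡y = refl , x≡y

enc-injective : ∀ t u → enc t ≡ enc u → t ≡ u
enc-injective t u eq = proj₁ (enc-++-E-injective t u {[]} {[]} (cong (_++ E ∷ []) eq))

balanced-N : ∀ h w → balanced h (N ∷ w) ≡ balanced (suc h) w
balanced-N zero    w = refl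
balanced-N (suc h) w = refl

balanced-enc-++ : ∀ h t x → balanced h (enc t ++ x) ≡ balanced h x
balanced-enc-++ h leaf       x = refl
balanced-enc-++ h (node l r) x = begin
  balanced h (enc (node l r) ++ x)               ≡⟨ cong (balanced h) (enc-node-++ l r x) ⟩
  balanced h (N ∷ (enc l ++ E ∷ (enc r ++ x)))   ≡⟨ balanced-N h _ ⟩
  balanced (suc h) (enc l ++ E ∷ (enc r ++ x))   ≡⟨ balanced-enc-++ (suc h) l _ ⟩
  balanced h (enc r ++ x)                        ≡⟨ balanced-enc-++ h r x ⟩
  balanced h x                                   ∎

encForest : ∀ {h} → Tree → Vec Tree h → List Step
encForest t []       = enc t
encForest t (u ∷ us) = enc t ++ E ∷ encForest u us

encForest-node : ∀ {h} l r (us : Vec Tree h) → encForest (node l r) us ≡ N ∷ (enc l ++ E ∷ encForest r us)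
encForest-node l r []       = refl
encForest-node l r (u ∷ us) = enc-node-++ l r (E ∷ encForest u us)

-- A balanced word of height h is enc t₀ E enc t₁ E ⋯ E enc tₕ.
parse : ∀ h w → T (balanced h w) → Σ Tree λ t → Σ (Vec Tree h) λ us → encForest t us ≡ w
parse zero    []      _ = leaf , [] , refl
parse h       (N ∷ w) p with parse (suc h) w (subst T (balanced-N h w) p)
... | t , u ∷ us , eq = node t u , us , trans (encForest-node t u us) (cong (N ∷_) eq)
parse (suc h) (E ∷ w) p with parse h w p
... | t , us , eq = leaf , t ∷ us , cong (E ∷_) eq

decode : ∀ w → T (balanced 0 w) → Σ Tree λ t → enc t ≡ w
decode w p with parse 0 w p
... | t , [] , enc-t≡w = t , enc-t≡w

Trees : ℕ → Set
Trees n = Σ Tree λ t → size t ≡ n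

pathOf : ∀ {n} → Trees n → CatalanPath n
pathOf (t , size≡n) = enc t , Equivalence.from T-∧
  ( ≡⇒≡ᵇ _ _ (trans (length-enc t) (cong (2 *_) size≡n))
  , subst T (sym balanced-enc) _ )
  where
  balanced-enc : balanced 0 (enc t) ≡ true
  balanced-enc = trans (cong (balanced 0) (sym (++-identityʳ (enc t)))) (balanced-enc-++ 0 t [])

treeOf : ∀ {n} → CatalanPath n → Trees n
treeOf {n} (w , p) = t , *-cancelˡ-≡ (size t) n 2 (begin
  2 * size t      ≡⟨ length-enc t ⟨
  length (enc t)  ≡⟨ cong length enc-t≡w ⟩
  length w        ≡⟨ ≡ᵇ⇒≡ _ _ (proj₁ (Equivalence.to T-∧ p)) ⟩
  2 * n           ∎)
  where
  t : Tree
  t = proj₁ (decode w (proj₂ (Equivalence.to T-∧ p)))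
  enc-t≡w : enc t ≡ w
  enc-t≡w = proj₂ (decode w (proj₂ (Equivalence.to T-∧ p)))

enc-treeOf : ∀ {n} (P : CatalanPath n) → enc (proj₁ (treeOf {n} P)) ≡ proj₁ P
enc-treeOf (w , p) = proj₂ (decode w (proj₂ (Equivalence.to T-∧ p)))

Trees-≡ : ∀ {n} {T U : Trees n} → enc (proj₁ T) ≡ enc (proj₁ U) → T ≡ U
Trees-≡ {T = t , e} {u , e′} eq with enc-injective t u eq
... | refl = cong (t ,_) (≡-irrelevant e e′)

CatalanPath-≡ : ∀ {n} {P Q : CatalanPath n} → proj₁ P ≡ proj₁ Q → P ≡ Q
CatalanPath-≡ {P = w , p} {.w , q} refl = cong (w ,_) (T-irrelevant p q)

catalan↔trees : ∀ n → CatalanPath n ↔ Trees n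
catalan↔trees n = mk↔ₛ′ (treeOf {n}) pathOf
  (λ T → Trees-≡ (enc-treeOf {n} (pathOf T)))
  (λ P → CatalanPath-≡ {n} (enc-treeOf {n} P))

TreesWith : (List Step → ℕ) → ℕ → ℕ → Set
TreesWith s n k = Σ (Trees n) λ T → s (enc (proj₁ T)) ≡ k

pathsWith↔treesWith : ∀ (s : List Step → ℕ) n k →
  Σ (CatalanPath n) (λ P → s (proj₁ P) ≡ k) ↔ TreesWith s n k
pathsWith↔treesWith s n k =
  Σ-↔ (catalan↔trees n) λ {P} → K-reflexive (cong (λ w → s w ≡ k) (sym (enc-treeOf {n} P)))

isNode : Tree → ℕ
isNode leaf       = 0
isNode (node _ _) = 1

valleys : Tree → ℕ
valleys leaf       = 0
valleys (node l r) = valleys l + (isNode r + valleys r)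

valley-E-enc-++ : ∀ t x → valley (E ∷ x) ≡ valley x →
  valley (E ∷ (enc t ++ x)) ≡ isNode t + valley (enc t ++ x)
valley-E-enc-++ leaf       x noValley = noValley
valley-E-enc-++ (node _ _) x _        = refl

-- The hypothesis says that x does not begin with N.
valley-enc-++ : ∀ t x → valley (E ∷ x) ≡ valley x → valley (enc t ++ x) ≡ valleys t + valley x
valley-enc-++ leaf       x _        = refl
valley-enc-++ (node l r) x noValley = begin
  valley (enc (node l r) ++ x)                   ≡⟨ cong valley (enc-node-++ l r x) ⟩
  valley (enc l ++ E ∷ (enc r ++ x))             ≡⟨ valley-enc-++ l _ refl ⟩
  valleys l + valley (E ∷ (enc r ++ x))          ≡⟨ cong (valleys l +_) (valley-E-enc-++ r x noValley) ⟩
  valleys l + (isNode r + valley (enc r ++ x))   ≡⟨ cong (λ v → valleys l + (isNode r + v)) (valley-enc-++ r x noValley) ⟩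
  valleys l + (isNode r + (valleys r + valley x)) ≡⟨ arith (valleys l) (isNode r) (valleys r) (valley x) ⟩
  valleys (node l r) + valley x                  ∎
  where
  arith : ∀ a b c d → a + (b + (c + d)) ≡ a + (b + c) + d
  arith = solve-∀

valley-enc : ∀ t → valley (enc t) ≡ valleys t
valley-enc t = begin
  valley (enc t)       ≡⟨ cong valley (++-identityʳ (enc t)) ⟨
  valley (enc t ++ []) ≡⟨ valley-enc-++ t [] refl ⟩
  valleys t + 0        ≡⟨ +-comm (valleys t) 0 ⟩
  valleys t            ∎

mutual
  evenNs : Tree → ℕ
  evenNs leaf       = 0
  evenNs (node l r) = oddNs l + evenNs r

  oddNs : Tree → ℕ
  oddNs leaf       = 0
  oddNs (node l r) = suc (evenNs l + oddNs r)

enor-∷-irrelevant : ∀ a b x → enor (a ∷ x) ≡ enor (b ∷ x)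
enor-∷-irrelevant a b []      = refl
enor-∷-irrelevant a b (N ∷ x) = refl
enor-∷-irrelevant a b (E ∷ x) = refl

mutual
  enor-enc-++ : ∀ t x → enor (enc t ++ x) ≡ evenNs t + enor x
  enor-enc-++ leaf       x = refl
  enor-enc-++ (node l r) x = begin
    enor (enc (node l r) ++ x)              ≡⟨ cong enor (enc-node-++ l r x) ⟩
    enor (N ∷ (enc l ++ E ∷ (enc r ++ x)))  ≡⟨ enor-∷-enc-++ N l _ ⟩
    oddNs l + enor (enc r ++ x)             ≡⟨ cong (oddNs l +_) (enor-enc-++ r x) ⟩
    oddNs l + (evenNs r + enor x)           ≡⟨ +-assoc (oddNs l) (evenNs r) (enor x) ⟨
    evenNs (node l r) + enor x              ∎

  enor-∷-enc-++ : ∀ a t x → enor (a ∷ (enc t ++ x)) ≡ oddNs t + enor (a ∷ x)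
  enor-∷-enc-++ a leaf       x = refl
  enor-∷-enc-++ a (node l r) x = cong suc (begin
    enor ((enc l ++ E ∷ enc r) ++ x)        ≡⟨ cong enor (++-assoc (enc l) (E ∷ enc r) x) ⟩
    enor (enc l ++ E ∷ (enc r ++ x))        ≡⟨ enor-enc-++ l _ ⟩
    evenNs l + enor (E ∷ (enc r ++ x))      ≡⟨ cong (evenNs l +_) (enor-∷-enc-++ E r x) ⟩
    evenNs l + (oddNs r + enor (E ∷ x))     ≡⟨ cong (λ e → evenNs l + (oddNs r + e)) (enor-∷-irrelevant E a x) ⟩
    evenNs l + (oddNs r + enor (a ∷ x))     ≡⟨ +-assoc (evenNs l) (oddNs r) (enor (a ∷ x)) ⟨
    evenNs l + oddNs r + enor (a ∷ x)       ∎)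

enor-enc : ∀ t → enor (enc t) ≡ evenNs t
enor-enc t = begin
  enor (enc t)       ≡⟨ cong enor (++-identityʳ (enc t)) ⟨
  enor (enc t ++ []) ≡⟨ enor-enc-++ t [] ⟩
  evenNs t + 0       ≡⟨ +-comm (evenNs t) 0 ⟩
  evenNs t           ∎

mutual
  φ : Tree → Tree
  φ leaf       = leaf
  φ (node l r) = node (ψ r) (φ l)

  ψ : Tree → Tree
  ψ leaf       = leaf
  ψ (node l r) = node (φ l) (ψ r)

mutual
  φ⁻¹ : Tree → Tree
  φ⁻¹ leaf       = leaf
  φ⁻¹ (node a b) = node (φ⁻¹ b) (ψ⁻¹ a)

  ψ⁻¹ : Tree → Tree
  ψ⁻¹ leaf       = leaf
  ψ⁻¹ (node a b) = node (φ⁻¹ a) (ψ⁻¹ b)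

mutual
  φ∘φ⁻¹ : ∀ t → φ (φ⁻¹ t) ≡ t
  φ∘φ⁻¹ leaf       = refl
  φ∘φ⁻¹ (node a b) = cong₂ node (ψ∘ψ⁻¹ a) (φ∘φ⁻¹ b)

  ψ∘ψ⁻¹ : ∀ t → ψ (ψ⁻¹ t) ≡ t
  ψ∘ψ⁻¹ leaf       = refl
  ψ∘ψ⁻¹ (node a b) = cong₂ node (φ∘φ⁻¹ a) (ψ∘ψ⁻¹ b)

mutual
  φ⁻¹∘φ : ∀ t → φ⁻¹ (φ t) ≡ t
  φ⁻¹∘φ leaf       = refl
  φ⁻¹∘φ (node a b) = cong₂ node (φ⁻¹∘φ a) (ψ⁻¹∘ψ b)

  ψ⁻¹∘ψ : ∀ t → ψ⁻¹ (ψ t) ≡ t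
  ψ⁻¹∘ψ leaf       = refl
  ψ⁻¹∘ψ (node a b) = cong₂ node (φ⁻¹∘φ a) (ψ⁻¹∘ψ b)

φ-↔ : Tree ↔ Tree
φ-↔ = mk↔ₛ′ φ φ⁻¹ φ∘φ⁻¹ φ⁻¹∘φ

mutual
  size-φ : ∀ t → size (φ t) ≡ size t
  size-φ leaf       = refl
  size-φ (node l r) = cong suc (trans (cong₂ _+_ (size-ψ r) (size-φ l)) (+-comm (size r) (size l)))

  size-ψ : ∀ t → size (ψ t) ≡ size t
  size-ψ leaf       = refl
  size-ψ (node l r) = cong suc (cong₂ _+_ (size-φ l) (size-ψ r))

mutual
  evenNs-φ : ∀ t → evenNs (φ t) ≡ valleys t
  evenNs-φ leaf       = refl
  evenNs-φ (node l r) = begin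
    oddNs (ψ r) + evenNs (φ l)        ≡⟨ cong₂ _+_ (oddNs-ψ r) (evenNs-φ l) ⟩
    (isNode r + valleys r) + valleys l ≡⟨ +-comm (isNode r + valleys r) (valleys l) ⟩
    valleys (node l r)                 ∎

  oddNs-ψ : ∀ t → oddNs (ψ t) ≡ isNode t + valleys t
  oddNs-ψ leaf       = refl
  oddNs-ψ (node l r) = cong suc (begin
    evenNs (φ l) + oddNs (ψ r)        ≡⟨ cong₂ _+_ (evenNs-φ l) (oddNs-ψ r) ⟩
    valleys l + (isNode r + valleys r) ∎)

enor-enc-φ : ∀ t → enor (enc (φ t)) ≡ valley (enc t)
enor-enc-φ t = begin
  enor (enc (φ t))  ≡⟨ enor-enc (φ t) ⟩
  evenNs (φ t)      ≡⟨ evenNs-φ t ⟩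
  valleys t         ≡⟨ valley-enc t ⟨
  valley (enc t)    ∎

φ-↔-Trees : ∀ n → Trees n ↔ Trees n
φ-↔-Trees n = Σ-↔ φ-↔ λ {t} → K-reflexive (cong (_≡ n) (sym (size-φ t)))

treesWithValley↔treesWithEnor : ∀ n k → TreesWith valley n k ↔ TreesWith enor n k
treesWithValley↔treesWithEnor n k =
  Σ-↔ (φ-↔-Trees n) λ {T} → K-reflexive (cong (_≡ k) (sym (enor-enc-φ (proj₁ T))))

-- The bijection exists for all n and k.
lemma4p2 : (n k : ℕ) → 1 ≤ n → k < n → A n k ⤖ B n k
lemma4p2 n k _ _ = ↔⇒⤖
  (↔-trans (pathsWith↔treesWith valley n k)
  (↔-trans (treesWithValley↔treesWithEnor n k)
           (↔-sym (pathsWith↔treesWith enor n k))))
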